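{- Let $\mathcal{G}$ be an $[n,k,d]_q$ A$^s$MDS code in $\mathrm{PG}(k-1,q)$. If some $(k-3)$-dimensional projective subspace $\Lambda$ meets $\mathcal{G}$ in $k-2+a$ points (counted with multiplicity), with $a\ge 0$, then \[ n\le (s+1-a)(q+1)+k-2+a. \]
   Context: A linear $[n,k,d]_q$ code is identified with a projective system: a finite multiset $\mathcal{G}$ of $n$ points (counted with multiplicity) of $\mathrm{PG}(k-1,q)$, not all lying in one hyperplane, with $n-d=\max_H|\mathcal{G}\cap H|$ over hyperplanes $H$ (counted with multiplicity). The Singleton defect is $n-k+1-d$; the code is A$^s$MDS if its defect is $s$. -}

module Defs where

open import Level using (0ℓ)
open import Data.Nat using (ℕ; suc; _+_; _≤_; _<_)
open import Data.Fin using (Fin; zero; suc)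
open import Data.List using (List; length; filter)
open import Data.List.Membership.Propositional using (_∈_)
open import Data.List.Relation.Unary.Unique.Propositional using (Unique)
open import Data.Product using (_×_; Σ)
open import Relation.Nullary using (¬_; Dec)
open import Relation.Nullary.Decidable using (_×-dec_)
open import Relation.Binary.PropositionalEquality using (_≡_; _≢_)
open import Relation.Binary.Definitions using (DecidableEquality)
open import Algebra.Structures using (IsCommutativeRing)

record FiniteField (q : ℕ) : Set₁ where
  field
    Carrier : Set
    _⊕_ _⊛_ : Carrier → Carrier → Carrier
    -_      : Carrier → Carrier
    0# 1#   : Carrier
    isCommutativeRing : IsCommutativeRing _≡_ _⊕_ _⊛_ -_ 0# 1#
    0≢1     : 0# ≢ 1#
    inverse : ∀ x → x ≢ 0# → Σ Carrier (λ y → (x ⊛ y) ≡ 1#)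
    _≟_     : DecidableEquality Carrier
    elements : List Carrier
    elements-unique : Unique elements
    elements-complete : ∀ x → x ∈ elements
    elements-count : length elements ≡ q

module Geometry {q : ℕ} (F : FiniteField q) where
  open FiniteField F

  Vec : ℕ → Set
  Vec k = Fin k → Carrier

  Nonzero : ∀ {k} → Vec k → Set
  Nonzero v = ¬ (∀ i → v i ≡ 0#)

  dot : ∀ {k} → Vec k → Vec k → Carrier
  dot {ℕ.zero} h v = 0#
  dot {suc k} h v = (h zero ⊛ v zero) ⊕ dot (λ i → h (suc i)) (λ i → v (suc i))

  -- A point of PG(k-1,q) is represented by a nonzero vector (up to scalars);
  -- a multiset of points is a list of such representatives.
  record Point (k : ℕ) : Set where
    constructor point
    field
      vec : Vec k
      nonzero : Nonzero vec

  -- A hyperplane of PG(k-1,q) is given by a nonzero linear functional h: H = {⟨v⟩ : h·v = 0}.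
  record Hyperplane (k : ℕ) : Set where
    constructor hyperplane
    field
      coeffs : Vec k
      nonzero : Nonzero coeffs

  -- A (k-3)-dimensional projective subspace of PG(k-1,q) (vector dimension k-2)
  -- is the intersection of two distinct hyperplanes, i.e. the common kernel of
  -- two linearly independent functionals.
  record Codim2 (k : ℕ) : Set where
    constructor codim2
    field
      h₁ h₂ : Vec k
      independent : ∀ α β → (∀ i → ((α ⊛ h₁ i) ⊕ (β ⊛ h₂ i)) ≡ 0#) → (α ≡ 0#) × (β ≡ 0#)

  countH : ∀ {k} → Hyperplane k → List (Point k) → ℕ
  countH H G = length (filter (λ p → dot (Hyperplane.coeffs H) (Point.vec p) ≟ 0#) G)

  inΛ? : ∀ {k} (Λ : Codim2 k) (p : Point k) →
         Dec ((dot (Codim2.h₁ Λ) (Point.vec p) ≡ 0#) × (dot (Codim2.h₂ Λ) (Point.vec p) ≡ 0#))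
  inΛ? Λ p = (dot (Codim2.h₁ Λ) (Point.vec p) ≟ 0#) ×-dec (dot (Codim2.h₂ Λ) (Point.vec p) ≟ 0#)

  countΛ : ∀ {k} → Codim2 k → List (Point k) → ℕ
  countΛ Λ G = length (filter (inΛ? Λ) G)

  Spanning : ∀ {k} → List (Point k) → Set
  Spanning {k} G = ∀ (H : Hyperplane k) → countH H G < length G

  -- G is (the projective system of) an [n,k,d]_q code:
  -- n = |G|, G spans, and n - d = max_H |G ∩ H|
  record IsCode {k : ℕ} (G : List (Point k)) (n d : ℕ) : Set where
    field
      length≡n    : length G ≡ n
      spanning    : Spanning G
      maxBound    : ∀ (H : Hyperplane k) → countH H G + d ≤ n
      maxAttained : Σ (Hyperplane k) (λ H → countH H G + d ≡ n)

{-# OPTIONS --safe #-}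
-- The hyperplanes through Λ form a pencil of q + 1 hyperplanes: the kernels of
-- h₁ + t h₂ (t ∈ F) and of h₂. A point of Λ lies on all of them, any other point
-- on at least one. Counting the incidences between G and the pencil therefore gives
-- q |G ∩ Λ| + n ≤ (q + 1)(n - d), because no hyperplane carries more than n - d
-- points of G; substituting |G ∩ Λ| = k - 2 + a and d = n - k + 1 - s gives the bound.
module Submission where

open import Defs
open import Data.Nat using (ℕ)
open import Data.List using (List; []; _∷_; length; filter; map)
open import Data.List.Properties using (filter-accept; filter-reject; filter-all; filter-some; length-map)
open import Data.List.Membership.Propositional using (lose)
open import Data.List.Membership.Propositional.Properties using (∈-map⁺)
open import Data.List.Relation.Unary.All using (All; _∷_; universal)
open import Data.List.Relation.Unary.All.Properties using (map⁺)
open import Data.List.Relation.Unary.Any using (Any; here; there)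
open import Data.Nat.ListAction using (sum)
open import Data.Product using (_×_; _,_; proj₁; proj₂)
open import Relation.Nullary using (¬_; Dec; yes; no)
open import Relation.Unary using (Decidable)
open import Relation.Binary.PropositionalEquality
  using (_≡_; refl; sym; trans; cong; cong₂; subst; subst₂; module ≡-Reasoning)
open import Algebra.Structures using (IsCommutativeRing)
open import Algebra.Bundles using (CommutativeSemigroup)
open import Level using (0ℓ)

module ListSums where
  open import Data.Nat using (_+_; _*_; _≤_; z≤n; suc)
  open import Data.Nat.Properties using (+-mono-≤; +-commutativeSemigroup)
  open import Algebra.Properties.CommutativeSemigroup +-commutativeSemigroup using (x∙yz≈y∙xz)

  count : {A : Set} {P : A → Set} → Decidable P → List A → ℕ
  count P? xs = length (filter P? xs)

  module _ {A : Set} {P : A → Set} (P? : Decidable P) {x : A} {xs : List A} where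

    count-accept : P x → count P? (x ∷ xs) ≡ suc (count P? xs)
    count-accept Px = cong length (filter-accept P? Px)

    count-reject : ¬ P x → count P? (x ∷ xs) ≡ count P? xs
    count-reject ¬Px = cong length (filter-reject P? ¬Px)

  sum-map-≤ : {A : Set} (f : A → ℕ) {m : ℕ} → (∀ x → f x ≤ m) →
              ∀ xs → sum (map f xs) ≤ length xs * m
  sum-map-≤ f f≤m []       = z≤n
  sum-map-≤ f f≤m (x ∷ xs) = +-mono-≤ (f≤m x) (sum-map-≤ f f≤m xs)

  module _ {A B : Set} {R : A → B → Set} (R? : ∀ x y → Dec (R x y)) where

    sum-count-[] : ∀ xs → sum (map (λ x → count (R? x) []) xs) ≡ 0
    sum-count-[] []       = refl
    sum-count-[] (x ∷ xs) = sum-count-[] xs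

    sum-count-∷ : ∀ y ys xs →
      sum (map (λ x → count (R? x) (y ∷ ys)) xs) ≡
      count (λ x → R? x y) xs + sum (map (λ x → count (R? x) ys) xs)
    sum-count-∷ y ys []       = refl
    sum-count-∷ y ys (x ∷ xs) rewrite sum-count-∷ y ys xs with R? x y
    ... | yes _ = cong suc
      (x∙yz≈y∙xz (count (R? x) ys) (count (λ x → R? x y) xs) (sum (map (λ x → count (R? x) ys) xs)))
    ... | no _  =
       x∙yz≈y∙xz (count (R? x) ys) (count (λ x → R? x y) xs) (sum (map (λ x → count (R? x) ys) xs))

    sum-count-comm : ∀ xs ys →
      sum (map (λ x → count (R? x) ys) xs) ≡ sum (map (λ y → count (λ x → R? x y) xs) ys)
    sum-count-comm xs []       = sum-count-[] xs
    sum-count-comm xs (y ∷ ys) =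
      trans (sum-count-∷ y ys xs) (cong (count (λ x → R? x y) xs +_) (sum-count-comm xs ys))

module Pencil {q : ℕ} (F : FiniteField q) where
  open import Data.Nat using (zero; suc; _+_; _*_; _∸_; _≤_; _<_)
  open import Data.Nat.Properties
    using (≤-reflexive; +-mono-≤; +-identityʳ; *-zeroʳ; +-suc; m≤n+m; m+n≤o⇒m≤o∸n; module ≤-Reasoning)
  open import Data.Nat.Solver using (module +-*-Solver)
  import Data.Fin as Fin
  open FiniteField F
  open Geometry F
  open Point using (vec)
  open Hyperplane using (coeffs)
  open IsCommutativeRing isCommutativeRing
    using (*-assoc; *-comm; distribˡ; distribʳ; zeroˡ; zeroʳ;
           *-identityˡ; *-identityʳ; +-identityˡ; -‿inverseʳ; +-isCommutativeSemigroup)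
  open ListSums

  ⊕-commutativeSemigroup : CommutativeSemigroup 0ℓ 0ℓ
  ⊕-commutativeSemigroup = record
    { Carrier = Carrier ; _≈_ = _≡_ ; _∙_ = _⊕_ ; isCommutativeSemigroup = +-isCommutativeSemigroup }

  open import Algebra.Properties.CommutativeSemigroup ⊕-commutativeSemigroup using (interchange)

  dot-⊕ˡ : ∀ {k} (u w v : Vec k) → dot (λ i → u i ⊕ w i) v ≡ dot u v ⊕ dot w v
  dot-⊕ˡ {zero} u w v = sym (+-identityˡ 0#)
  dot-⊕ˡ {suc k}  u w v = begin
    ((u₀ ⊕ w₀) ⊛ v₀) ⊕ dot (λ i → u (Fin.suc i) ⊕ w (Fin.suc i)) v′
      ≡⟨ cong₂ _⊕_ (distribʳ v₀ u₀ w₀) (dot-⊕ˡ (λ i → u (Fin.suc i)) (λ i → w (Fin.suc i)) v′) ⟩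
    ((u₀ ⊛ v₀) ⊕ (w₀ ⊛ v₀)) ⊕ (dot (λ i → u (Fin.suc i)) v′ ⊕ dot (λ i → w (Fin.suc i)) v′)
      ≡⟨ interchange _ _ _ _ ⟩
    dot u v ⊕ dot w v ∎
    where
      u₀ = u Fin.zero
      w₀ = w Fin.zero
      v₀ = v Fin.zero
      v′ = λ i → v (Fin.suc i)
      open ≡-Reasoning

  dot-⊛ˡ : ∀ {k} (t : Carrier) (u v : Vec k) → dot (λ i → t ⊛ u i) v ≡ t ⊛ dot u v
  dot-⊛ˡ {zero} t u v = sym (zeroʳ t)
  dot-⊛ˡ {suc k}  t u v = begin
    ((t ⊛ u₀) ⊛ v₀) ⊕ dot (λ i → t ⊛ u (Fin.suc i)) v′
      ≡⟨ cong₂ _⊕_ (*-assoc t u₀ v₀) (dot-⊛ˡ t (λ i → u (Fin.suc i)) v′) ⟩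
    (t ⊛ (u₀ ⊛ v₀)) ⊕ (t ⊛ dot (λ i → u (Fin.suc i)) v′)
      ≡⟨ distribˡ t _ _ ⟨
    t ⊛ dot u v ∎
    where
      u₀ = u Fin.zero
      v₀ = v Fin.zero
      v′ = λ i → v (Fin.suc i)
      open ≡-Reasoning

  _∋_ : ∀ {k} → Hyperplane k → Point k → Set
  H ∋ p = dot (coeffs H) (vec p) ≡ 0#

  _∋?_ : ∀ {k} (H : Hyperplane k) (p : Point k) → Dec (H ∋ p)
  H ∋? p = dot (coeffs H) (vec p) ≟ 0#

  IsCode⇒d≤n : ∀ {k n d} {G : List (Point k)} → IsCode G n d → d ≤ n
  IsCode⇒d≤n {d = d} {G} code with IsCode.maxAttained code
  ... | H , countH+d≡n = subst (d ≤_) countH+d≡n (m≤n+m d (countH H G))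

  module _ {k : ℕ} (Λ : Codim2 k) where
    open Codim2 Λ

    pencilMember : Carrier → Hyperplane k
    pencilMember t = hyperplane (λ i → h₁ i ⊕ (t ⊛ h₂ i)) λ h₁+th₂≡0 →
      0≢1 (sym (proj₁ (independent 1# t λ i →
        trans (cong (_⊕ (t ⊛ h₂ i)) (*-identityˡ (h₁ i))) (h₁+th₂≡0 i))))

    pencilMember∞ : Hyperplane k
    pencilMember∞ = hyperplane h₂ λ h₂≡0 →
      0≢1 (sym (proj₂ (independent 0# 1# λ i →
        trans (cong₂ _⊕_ (zeroˡ (h₁ i)) (*-identityˡ (h₂ i))) (trans (+-identityˡ (h₂ i)) (h₂≡0 i)))))

    pencil : List (Hyperplane k)
    pencil = pencilMember∞ ∷ map pencilMember elements

    length-pencil : length pencil ≡ suc q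
    length-pencil = cong suc (trans (length-map pencilMember elements) elements-count)

    dot-pencilMember : ∀ t v → dot (coeffs (pencilMember t)) v ≡ dot h₁ v ⊕ (t ⊛ dot h₂ v)
    dot-pencilMember t v = trans (dot-⊕ˡ h₁ _ v) (cong (dot h₁ v ⊕_) (dot-⊛ˡ t h₂ v))

    pencil-⊇Λ : ∀ p → (dot h₁ (vec p) ≡ 0#) × (dot h₂ (vec p) ≡ 0#) → All (_∋ p) pencil
    pencil-⊇Λ p (h₁p≡0 , h₂p≡0) = h₂p≡0 ∷ map⁺ (universal member∋p elements)
      where
        member∋p : ∀ t → pencilMember t ∋ p
        member∋p t = begin
          dot (coeffs (pencilMember t)) (vec p) ≡⟨ dot-pencilMember t (vec p) ⟩
          dot h₁ (vec p) ⊕ (t ⊛ dot h₂ (vec p)) ≡⟨ cong₂ (λ x y → x ⊕ (t ⊛ y)) h₁p≡0 h₂p≡0 ⟩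
          0# ⊕ (t ⊛ 0#)                         ≡⟨ trans (+-identityˡ _) (zeroʳ t) ⟩
          0# ∎
          where open ≡-Reasoning

    -- A point off the axis ker h₂ lies on ker (h₁ + t h₂) for t = - (h₁·v) / (h₂·v).
    pencil-covers : ∀ p → Any (_∋ p) pencil
    pencil-covers p with dot h₂ (vec p) ≟ 0#
    ... | yes h₂p≡0 = here h₂p≡0
    ... | no  h₂p≢0 = there (lose (∈-map⁺ pencilMember (elements-complete t)) member∋p)
      where
        v = vec p
        y = proj₁ (inverse (dot h₂ v) h₂p≢0)
        t = (- dot h₁ v) ⊛ y
        member∋p : pencilMember t ∋ p
        member∋p = begin
          dot (coeffs (pencilMember t)) v        ≡⟨ dot-pencilMember t v ⟩
          dot h₁ v ⊕ (((- dot h₁ v) ⊛ y) ⊛ dot h₂ v) ≡⟨ cong (dot h₁ v ⊕_) (*-assoc _ y _) ⟩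
          dot h₁ v ⊕ ((- dot h₁ v) ⊛ (y ⊛ dot h₂ v)) ≡⟨ cong (λ z → dot h₁ v ⊕ ((- dot h₁ v) ⊛ z))
                                                         (trans (*-comm y _) (proj₂ (inverse (dot h₂ v) h₂p≢0))) ⟩
          dot h₁ v ⊕ ((- dot h₁ v) ⊛ 1#)          ≡⟨ cong (dot h₁ v ⊕_) (*-identityʳ _) ⟩
          dot h₁ v ⊕ (- dot h₁ v)                 ≡⟨ -‿inverseʳ _ ⟩
          0# ∎
          where open ≡-Reasoning

    incidences : Point k → ℕ
    incidences p = count (_∋? p) pencil

    incidences-Λ : ∀ p → (dot h₁ (vec p) ≡ 0#) × (dot h₂ (vec p) ≡ 0#) → incidences p ≡ suc q
    incidences-Λ p p∈Λ = trans (cong length (filter-all (_∋? p) (pencil-⊇Λ p p∈Λ))) length-pencil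

    incidences-pos : ∀ p → 0 < incidences p
    incidences-pos p = filter-some (_∋? p) (pencil-covers p)

    incidences-lowerBound : ∀ G → q * countΛ Λ G + length G ≤ sum (map incidences G)
    incidences-lowerBound []      = ≤-reflexive (trans (+-identityʳ (q * 0)) (*-zeroʳ q))
    incidences-lowerBound (p ∷ G) with inΛ? Λ p
    ... | yes p∈Λ = begin
      q * countΛ Λ (p ∷ G) + suc (length G) ≡⟨ cong (λ c → q * c + suc (length G)) (count-accept (inΛ? Λ) p∈Λ) ⟩
      q * suc (countΛ Λ G) + suc (length G) ≡⟨ regroup q (countΛ Λ G) (length G) ⟩
      suc q + (q * countΛ Λ G + length G)   ≤⟨ +-mono-≤ (≤-reflexive (sym (incidences-Λ p p∈Λ)))
                                                        (incidences-lowerBound G) ⟩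
      incidences p + sum (map incidences G) ∎
      where
        open ≤-Reasoning
        open +-*-Solver
        regroup : ∀ q c l → q * suc c + suc l ≡ suc q + (q * c + l)
        regroup = solve 3 (λ q c l → q :* (con 1 :+ c) :+ (con 1 :+ l) := (con 1 :+ q) :+ (q :* c :+ l)) refl
    ... | no p∉Λ = begin
      q * countΛ Λ (p ∷ G) + suc (length G) ≡⟨ cong (λ c → q * c + suc (length G)) (count-reject (inΛ? Λ) p∉Λ) ⟩
      q * countΛ Λ G + suc (length G)       ≡⟨ +-suc _ _ ⟩
      suc (q * countΛ Λ G + length G)       ≤⟨ +-mono-≤ (incidences-pos p) (incidences-lowerBound G) ⟩
      incidences p + sum (map incidences G) ∎
      where open ≤-Reasoning

    pencil-bound : ∀ {G : List (Point k)} {n d} → IsCode G n d → q * countΛ Λ G + n ≤ suc q * (n ∸ d)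
    pencil-bound {G} {n} {d} code = begin
      q * countΛ Λ G + n                  ≡⟨ cong (q * countΛ Λ G +_) length≡n ⟨
      q * countΛ Λ G + length G           ≤⟨ incidences-lowerBound G ⟩
      sum (map incidences G)              ≡⟨ sum-count-comm _∋?_ pencil G ⟨
      sum (map (λ H → countH H G) pencil) ≤⟨ sum-map-≤ (λ H → countH H G)
                                                (λ H → m+n≤o⇒m≤o∸n (countH H G) (maxBound H)) pencil ⟩
      length pencil * (n ∸ d)             ≡⟨ cong (_* (n ∸ d)) length-pencil ⟩
      suc q * (n ∸ d)                     ∎
      where
        open IsCode code
        open ≤-Reasoning

open import Data.Integer using (ℤ; +_; _+_; _-_; _*_; _≤_; 0ℤ; +≤+)
open import Data.Integer.Properties using (pos-+; pos-*; m-n≡m⊖n; ⊖-≥; i≤j⇒0≤j-i; 0≤i-j⇒j≤i)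
open import Data.Integer.Solver using (module +-*-Solver)
import Data.Nat as ℕ

pencil-bound⇒defect-bound : ∀ {n k d a q c : ℕ} → d ℕ.≤ n →
  q ℕ.* c ℕ.+ n ℕ.≤ ℕ.suc q ℕ.* (n ℕ.∸ d) → + c ≡ + k - + 2 + + a →
  + n ≤ ((+ n - + k + + 1 - + d + + 1 - + a) * (+ q + + 1)) + + k - + 2 + + a
pencil-bound⇒defect-bound {n} {k} {d} {a} {q} {c} d≤n bound c≡ =
  0≤i-j⇒j≤i (subst (0ℤ ≤_) (sym (regroup (+ n) (+ k) (+ d) (+ a) (+ q)))
    (i≤j⇒0≤j-i (subst₂ _≤_ lhs rhs (+≤+ bound))))
  where
    lhs : + (q ℕ.* c ℕ.+ n) ≡ + q * (+ k - + 2 + + a) + + n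
    lhs = trans (pos-+ (q ℕ.* c) n) (cong (_+ + n) (trans (pos-* q c) (cong (+ q *_) c≡)))
    rhs : + (ℕ.suc q ℕ.* (n ℕ.∸ d)) ≡ (+ 1 + + q) * (+ n - + d)
    rhs = trans (pos-* (ℕ.suc q) (n ℕ.∸ d))
                (cong₂ _*_ (pos-+ 1 q) (sym (trans (m-n≡m⊖n n d) (⊖-≥ d≤n))))
    open +-*-Solver
    regroup : ∀ N K D A Q →
      ((N - K + + 1 - D + + 1 - A) * (Q + + 1)) + K - + 2 + A - N ≡
      (+ 1 + Q) * (N - D) - (Q * (K - + 2 + A) + N)
    regroup = solve 5 (λ N K D A Q →
      ((N :- K :+ con (+ 1) :- D :+ con (+ 1) :- A) :* (Q :+ con (+ 1))) :+ K :- con (+ 2) :+ A :- N :=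
      (con (+ 1) :+ Q) :* (N :- D) :- (Q :* (K :- con (+ 2) :+ A) :+ N)) refl

mainTheorem6 : ∀ {q : ℕ} (F : FiniteField q) (n k d : ℕ) (s : ℤ) (a : ℕ)
    (G : List (Geometry.Point F k)) →
    Geometry.IsCode F G n d →
    s ≡ (+ n - + k + + 1 - + d) →
    (Λ : Geometry.Codim2 F k) →
    + Geometry.countΛ F Λ G ≡ + k - + 2 + + a →
    + n ≤ ((s + + 1 - + a) * (+ q + + 1)) + + k - + 2 + + a
mainTheorem6 {q} F n k d s a G code refl Λ |G∩Λ|≡k-2+a =
  pencil-bound⇒defect-bound {k = k} {a = a} {q = q} (IsCode⇒d≤n code) (pencil-bound Λ code) |G∩Λ|≡k-2+a
  where open Pencil F
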